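{- Let $(X,\le)$ be a dcpo endowed with its Scott topology. Then $X$ is scattered if and only if there is no infinite strictly ascending chain $x_0<x_1<\cdots$ in $X$.
   Context: A dcpo is a poset in which every nonempty directed subset has a supremum. Its Scott topology consists of the upward closed sets $U$ such that $U\cap D\neq\emptyset$ for every nonempty directed $D$ whose supremum lies in $U$. A space $X$ is scattered if $\bigcap_{\alpha}X^{(\alpha)}=\emptyset$, where $X^{(0)}=X$, $X^{(\alpha+1)}$ is the set of non-isolated points of $X^{(\alpha)}$ (in its subspace topology), and $X^{(\lambda)}=\bigcap_{\beta<\lambda}X^{(\beta)}$ for limit $\lambda$. -}

module Defs where

open import Level using (Level; 0ℓ) renaming (suc to lsuc)
open import Data.Unit using (⊤)
open import Data.Nat using (ℕ; suc)
open import Data.Product using (Σ; _×_; _,_)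
open import Relation.Nullary using (¬_)
open import Relation.Unary using (Pred; _∈_)
open import Relation.Binary.Bundles using (Poset)

-- Brouwer-style ordinals with limits over arbitrary index types in Set.
-- olim f denotes the supremum of the ordinals f i.
data Ord : Set₁ where
  ozero : Ord
  osuc  : Ord → Ord
  olim  : {I : Set} → (I → Ord) → Ord

module _ (P : Poset 0ℓ 0ℓ 0ℓ) where
  open Poset P renaming (Carrier to X)

  _<_ : X → X → Set
  x < y = (x ≤ y) × ¬ (x ≈ y)

  IsUpperBound : Pred X 0ℓ → X → Set
  IsUpperBound D s = ∀ d → d ∈ D → d ≤ s

  IsSup : Pred X 0ℓ → X → Set
  IsSup D s = IsUpperBound D s × (∀ u → IsUpperBound D u → s ≤ u)

  Directed : Pred X 0ℓ → Set
  Directed D = Σ X (λ x → x ∈ D)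
             × (∀ x y → x ∈ D → y ∈ D → Σ X (λ z → z ∈ D × x ≤ z × y ≤ z))

  IsDcpo : Set₁
  IsDcpo = ∀ (D : Pred X 0ℓ) → Directed D → Σ X (IsSup D)

  UpperSet : Pred X 0ℓ → Set
  UpperSet U = ∀ x y → x ∈ U → x ≤ y → y ∈ U

  ScottOpen : Pred X 0ℓ → Set₁
  ScottOpen U = UpperSet U
              × (∀ (D : Pred X 0ℓ) → Directed D → ∀ s → IsSup D s → s ∈ U
                   → Σ X (λ d → d ∈ D × d ∈ U))

  IsolatedIn : Pred X (lsuc 0ℓ) → X → Set₁
  IsolatedIn A x = x ∈ A
                 × Σ (Pred X 0ℓ) (λ U → ScottOpen U × x ∈ U
                       × (∀ y → y ∈ U → y ∈ A → y ≈ x))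

  derived : Ord → Pred X (lsuc 0ℓ)
  derived ozero    x = Level.Lift (lsuc 0ℓ) ⊤
  derived (osuc α) x = x ∈ derived α × ¬ IsolatedIn (derived α) x
  derived (olim f) x = ∀ i → x ∈ derived (f i)

  Scattered : Set₁
  Scattered = ∀ x → ¬ (∀ (α : Ord) → x ∈ derived α)

  AscendingChain : Set
  AscendingChain = Σ (ℕ → X) (λ f → ∀ n → f n < f (suc n))

-- An ascending chain together with its supremum can never be separated by the Cantor–Bendixson
-- derivatives: each chain element is non-isolated because its successor lies in every open set
-- around it, and the supremum is non-isolated because Scott-open sets around it meet the chain.
-- Conversely, without ascending chains every nonempty set has a maximal element; in particular
-- every directed set has a greatest element, so principal upsets ↑m are Scott-open. A maximal
-- point m among those lying in all derivatives would then be isolated in the stage after all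
-- strictly larger points have disappeared, contradicting its surviving the next derivative.
module Submission where

open import Defs
open import Level using (0ℓ; Lift; lift; lower) renaming (suc to lsuc)
open import Relation.Nullary using (¬_)
open import Relation.Unary using (Pred; _∈_)
open import Relation.Binary.Bundles using (Poset)
open import Axiom.ExcludedMiddle using (ExcludedMiddle)
open import Axiom.DoubleNegationElimination using (DoubleNegationElimination; em⇒dne)
open import Function.Bundles using (_⇔_; mk⇔)
open import Data.Nat using (ℕ; zero; suc; _+_)
open import Data.Nat.Properties using (+-comm)
open import Data.Product using (Σ; _×_; _,_; proj₁; proj₂)
open import Relation.Binary.PropositionalEquality using (_≡_; refl; subst)

module _ (P : Poset 0ℓ 0ℓ 0ℓ) where
  open Poset P renaming (Carrier to X; refl to ≤-refl)

  ascendingChain-from-noMaximal : ∀ {ℓ} (Q : Pred X ℓ) → Σ X Q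
    → (∀ y → y ∈ Q → Σ X λ z → z ∈ Q × _<_ P y z) → AscendingChain P
  ascendingChain-from-noMaximal Q (x , x∈Q) step =
    (λ n → proj₁ (chain n)) , (λ n → proj₂ (proj₂ (step _ (proj₂ (chain n)))))
    where
    chain : ℕ → Σ X Q
    chain zero    = x , x∈Q
    chain (suc n) = let (z , z∈Q , _) = step _ (proj₂ (chain n)) in z , z∈Q

  module AscendingChainProperties {f : ℕ → X} (ascending : ∀ n → _<_ P (f n) (f (suc n))) where

    ≤-+ : ∀ i k → f i ≤ f (k + i)
    ≤-+ i zero    = ≤-refl
    ≤-+ i (suc k) = trans (≤-+ i k) (proj₁ (ascending (k + i)))

    range : Pred X 0ℓ
    range y = Σ ℕ λ n → f n ≡ y

    range-directed : Directed P range
    range-directed = (f 0 , 0 , refl) , upperBound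
      where
      upperBound : ∀ x y → x ∈ range → y ∈ range → Σ X λ z → z ∈ range × x ≤ z × y ≤ z
      upperBound _ _ (i , refl) (j , refl) =
        f (j + i) , (j + i , refl) , ≤-+ i j , subst (λ n → f j ≤ f n) (+-comm i j) (≤-+ j i)

    upperBound-≉ : ∀ {s} → IsUpperBound P range s → ∀ n → ¬ f n ≈ s
    upperBound-≉ ub n fn≈s = proj₂ (ascending n)
      (antisym (proj₁ (ascending n)) (trans (ub _ (suc n , refl)) (reflexive (Eq.sym fn≈s))))

    element-notIsolated : ∀ A n → f (suc n) ∈ A → ¬ IsolatedIn P A (f n)
    element-notIsolated A n fsn∈A (_ , U , (upper , _) , fn∈U , onlyPoint) =
      proj₂ (ascending n)
        (Eq.sym (onlyPoint _ (upper _ _ fn∈U (proj₁ (ascending n))) fsn∈A))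

    sup-notIsolated : ∀ A {s} → IsSup P range s → (∀ n → f n ∈ A) → ¬ IsolatedIn P A s
    sup-notIsolated A sup range⊆A (_ , U , (_ , inaccessible) , s∈U , onlyPoint)
      with inaccessible range range-directed _ sup s∈U
    ... | _ , (n , refl) , fn∈U = upperBound-≉ (proj₁ sup) n (onlyPoint _ fn∈U (range⊆A n))

    range-∪-sup-⊆-derived : ∀ {s} → IsSup P range s
      → ∀ α → (∀ n → f n ∈ derived P α) × s ∈ derived P α
    range-∪-sup-⊆-derived sup ozero    = (λ _ → lift _) , lift _
    range-∪-sup-⊆-derived sup (osuc α) =
      (λ n → range⊆ n , element-notIsolated _ n (range⊆ (suc n)))
      , s∈ , sup-notIsolated _ sup range⊆
      where
      range⊆ = proj₁ (range-∪-sup-⊆-derived sup α)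
      s∈     = proj₂ (range-∪-sup-⊆-derived sup α)
    range-∪-sup-⊆-derived sup (olim g) =
      (λ n i → proj₁ (range-∪-sup-⊆-derived sup (g i)) n)
      , (λ i → proj₂ (range-∪-sup-⊆-derived sup (g i)))

  scattered⇒noAscendingChain : IsDcpo P → Scattered P → ¬ AscendingChain P
  scattered⇒noAscendingChain dcpo scattered (f , ascending) =
    scattered s λ α → proj₂ (range-∪-sup-⊆-derived sup α)
    where
    open AscendingChainProperties ascending
    s   = proj₁ (dcpo range range-directed)
    sup = proj₂ (dcpo range range-directed)

module _ (em : ExcludedMiddle (lsuc 0ℓ)) (P : Poset 0ℓ 0ℓ 0ℓ) where
  open Poset P renaming (Carrier to X; refl to ≤-refl)

  private
    dne : DoubleNegationElimination (lsuc 0ℓ)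
    dne = em⇒dne em

    dne₀ : {A : Set} → ¬ ¬ A → A
    dne₀ ¬¬a = lower (dne λ ¬a → ¬¬a λ a → ¬a (lift a))

  module _ (noChain : ¬ AscendingChain P) where

    ∃-maximal : (Q : Pred X (lsuc 0ℓ)) → Σ X Q
      → Σ X λ m → m ∈ Q × (∀ z → z ∈ Q → m ≤ z → z ≈ m)
    ∃-maximal Q nonempty = dne λ noMaximal →
      noChain (ascendingChain-from-noMaximal P Q nonempty λ y y∈Q → dne λ noSuccessor →
        noMaximal (y , y∈Q , λ z z∈Q y≤z → dne₀ λ z≉y →
          noSuccessor (z , z∈Q , y≤z , λ y≈z → z≉y (Eq.sym y≈z))))

    ↑-scottOpen : ∀ m → ScottOpen P (m ≤_)
    ↑-scottOpen m = (λ _ _ m≤x x≤y → trans m≤x x≤y) , inaccessible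
      where
      inaccessible : ∀ D → Directed P D → ∀ s → IsSup P D s → m ≤ s → Σ X λ d → d ∈ D × m ≤ d
      inaccessible D ((x , x∈D) , directed) s sup m≤s
        with ∃-maximal (λ d → Lift _ (d ∈ D)) (x , lift x∈D)
      ... | d , lift d∈D , maximal = d , d∈D , trans m≤s (proj₂ sup d greatest)
        where
        greatest : IsUpperBound P D d
        greatest e e∈D with directed d e d∈D e∈D
        ... | z , z∈D , d≤z , e≤z = trans e≤z (reflexive (maximal z (lift z∈D) d≤z))

    isolated-once-strictUpperBounds-removed : ∀ m
      → (∀ y → m ≤ y → ¬ y ≈ m → Σ Ord λ α → ¬ y ∈ derived P α)
      → Σ Ord λ β → m ∈ derived P β → IsolatedIn P (derived P β) m
    isolated-once-strictUpperBounds-removed m removed =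
      β , λ m∈β → m∈β , (m ≤_) , ↑-scottOpen m , ≤-refl , onlyPoint
      where
      β : Ord
      β = olim {Σ X λ y → m ≤ y × ¬ y ≈ m} λ (y , m≤y , y≉m) → proj₁ (removed y m≤y y≉m)

      onlyPoint : ∀ y → m ≤ y → y ∈ derived P β → y ≈ m
      onlyPoint y m≤y y∈β = dne₀ λ y≉m →
        proj₂ (removed y m≤y y≉m) (y∈β (y , m≤y , y≉m))

    Survivor : Pred X (lsuc 0ℓ)
    Survivor y = ∀ α → y ∈ derived P α

    noAscendingChain⇒scattered : Scattered P
    noAscendingChain⇒scattered x x∈Survivor =
      let m , m∈Survivor , maximal = ∃-maximal Survivor (x , x∈Survivor)
          β , isolated = isolated-once-strictUpperBounds-removed m (removed m maximal)
      in proj₂ (m∈Survivor (osuc β)) (isolated (m∈Survivor β))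
      where
      removed : ∀ m → (∀ y → y ∈ Survivor → m ≤ y → y ≈ m)
        → ∀ y → m ≤ y → ¬ y ≈ m → Σ Ord λ α → ¬ y ∈ derived P α
      removed m maximal y m≤y y≉m = dne λ survives →
        y≉m (maximal y (λ α → dne λ y∉α → survives (α , y∉α)) m≤y)

proposition2p5 : ExcludedMiddle (lsuc 0ℓ) → (P : Poset 0ℓ 0ℓ 0ℓ) → IsDcpo P
    → Scattered P ⇔ (¬ AscendingChain P)
proposition2p5 em P dcpo =
  mk⇔ (scattered⇒noAscendingChain P dcpo) (noAscendingChain⇒scattered em P)
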